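{- Let $M = WW^\top$, where $W$ is the inclusion matrix of $E(K_{n,n,n})$ versus the triangles of $K_{n,n,n}$, let $K$ be the orthogonal projection onto $\ker(M)$, and let $A = M + 2n K$. Then $A$ is invertible and $\|A^{ -1}\|_\infty \le \frac{23}{9n} + O(n^{ -2})$ as $n\to\infty$.
   Context: $K_{n,n,n}$ is the complete $3$-partite graph with three parts of size $n$; matrices are indexed by $E(K_{n,n,n})$. The inclusion matrix has $(e,t)$-entry $1$ if edge $e$ lies in triangle $t$, else $0$. $\|C\|_\infty = \max_i\sum_j |C(i,j)|$ is the maximum absolute row sum. -}

module Defs where

open import Data.Nat as ℕ using (ℕ; zero; suc)
open import Data.Fin using (Fin; zero; suc)
open import Data.Product using (_×_; _,_; Σ; ∃)
open import Data.Integer as ℤ using (ℤ)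
open import Data.Rational as ℚ using (ℚ; 0ℚ; 1ℚ; _+_; _*_; _≤_; ∣_∣; _⊔_; _/_)
open import Relation.Binary.PropositionalEquality using (_≡_)
open import Relation.Nullary using (yes; no)
open import Data.Fin using (_≟_)

sumFin : (k : ℕ) → (Fin k → ℚ) → ℚ
sumFin zero    f = 0ℚ
sumFin (suc k) f = f zero + sumFin k (λ i → f (suc i))

maxFin : (k : ℕ) → (Fin k → ℚ) → ℚ
maxFin zero    f = 0ℚ
maxFin (suc k) f = f zero ⊔ maxFin k (λ i → f (suc i))

-- Vertices of K_{n,n,n}: part p ∈ Fin 3, index in Fin n.
-- An edge of K_{n,n,n} joins two distinct parts; we index it by the part it
-- MISSES (Fin 3) together with the indices of its two endpoints, taken in the
-- increasing order of the two parts it meets: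
--   (zero , i , j)          = { (1,i) , (2,j) }
--   (suc zero , i , j)      = { (0,i) , (2,j) }
--   (suc (suc zero) , i , j) = { (0,i) , (1,j) }
-- This is a bijection with E(K_{n,n,n}) (3n² edges).
Edge : ℕ → Set
Edge n = Fin 3 × Fin n × Fin n

-- A triangle of K_{n,n,n} is a choice of one vertex in each part.
Triangle : ℕ → Set
Triangle n = Fin n × Fin n × Fin n

sumEdge : (n : ℕ) → (Edge n → ℚ) → ℚ
sumEdge n f = sumFin 3 (λ c → sumFin n (λ i → sumFin n (λ j → f (c , i , j))))

sumTri : (n : ℕ) → (Triangle n → ℚ) → ℚ
sumTri n f = sumFin n (λ a → sumFin n (λ b → sumFin n (λ c → f (a , b , c))))

maxEdge : (n : ℕ) → (Edge n → ℚ) → ℚ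
maxEdge n f = maxFin 3 (λ c → maxFin n (λ i → maxFin n (λ j → f (c , i , j))))

δ : {n : ℕ} → Fin n → Fin n → ℚ
δ x y with x ≟ y
... | yes _ = 1ℚ
... | no  _ = 0ℚ

W : (n : ℕ) → Edge n → Triangle n → ℚ
W n (zero , i , j)             (a , b , c) = δ i b * δ j c
W n (suc zero , i , j)         (a , b , c) = δ i a * δ j c
W n (suc (suc zero) , i , j)   (a , b , c) = δ i a * δ j b

EMat : ℕ → Set
EMat n = Edge n → Edge n → ℚ

M : (n : ℕ) → EMat n
M n e f = sumTri n (λ t → W n e t * W n f t)

_·_ : {n : ℕ} → EMat n → EMat n → EMat n
_·_ {n} P Q e f = sumEdge n (λ g → P e g * Q g f)

Id : (n : ℕ) → EMat n
Id n (c , i , j) (c' , i' , j') = δ c c' * δ i i' * δ j j'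

apply : {n : ℕ} → EMat n → (Edge n → ℚ) → (Edge n → ℚ)
apply {n} P x e = sumEdge n (λ g → P e g * x g)

record IsOrthProjOntoKer {n : ℕ} (N K : EMat n) : Set where
  field
    symmetric  : ∀ e f → K e f ≡ K f e
    idempotent : ∀ e f → (K · K) e f ≡ K e f
    image⊆ker  : ∀ x e → apply N (apply K x) e ≡ 0ℚ
    ker⊆image  : ∀ x → (∀ e → apply N x e ≡ 0ℚ) → ∀ e → apply K x e ≡ x e

Amat : (n : ℕ) → EMat n → EMat n
Amat n K e f = M n e f + (ℤ.+ (2 ℕ.* n) / 1) * K e f

IsInverse : {n : ℕ} → EMat n → EMat n → Set
IsInverse {n} A B = (∀ e f → (A · B) e f ≡ Id n e f) × (∀ e f → (B · A) e f ≡ Id n e f)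

normInf : {n : ℕ} → EMat n → ℚ
normInf {n} C = maxEdge n (λ e → sumEdge n (λ f → ∣ C e f ∣))

-- 1/n as a rational (only used for n ≥ 1).
recip : ℕ → ℚ
recip zero    = 0ℚ
recip (suc m) = ℤ.+ 1 / suc m

-- Matrices on E(K_{n,n,n}) whose (e, f) entry only depends on how e and f meet (same class or
-- not, and which coordinates agree) form a five-dimensional algebra, and it is closed under
-- multiplication by M = W Wᵀ because (M X)(e, f) sums X(g, f) over the edges g of the n triangles
-- through e. In this algebra, with u = 1/n, there are explicit B, Z and P with P symmetric,
-- M P = 0, M B = Id − P and B = M Z + (u/2) Id. The first three facts force the orthogonal
-- projection K onto ker M to be P; the last gives K B = (u/2) K, hence (M + 2n K) B = Id, and B is
-- symmetric, so it is the inverse. Every row of |B| sums to exactly 23u/9 − 34u²/9 + 16u³/9, so the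
-- bound holds with no second-order term at all.
module Submission where

open import Defs
open import Data.Nat using (ℕ; _≤_)
open import Data.Product using (_×_; Σ)
open import Data.Rational as ℚ using (ℚ; _+_; _*_; _/_)
open import Data.Integer using (+_)

open import Algebra.Bundles using (CommutativeRing)
open import Data.Empty using (⊥-elim)
open import Data.Fin using (Fin; zero; suc)
import Data.Fin.Properties as FinP
import Data.Integer as ℤ
import Data.Integer.Properties as ℤP
open import Data.List using (_∷_; [])
open import Data.Nat as ℕ using (zero; suc; s≤s; z≤n)
import Data.Nat.Properties as ℕP
import Data.Nat.Tactic.RingSolver as ℕ-Ring
open import Data.Product using (_,_; proj₁)
open import Data.Rational using (0ℚ; 1ℚ; -_; _-_; ∣_∣)
import Data.Rational.Properties as ℚP
open import Data.Rational.Unnormalised as ℚᵘ using (mkℚᵘ; *≡*)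
import Data.Rational.Unnormalised.Properties as ℚᵘP
open import Level using (0ℓ)
open import Relation.Binary.PropositionalEquality
open import Relation.Nullary using (yes; no)
open import Relation.Nullary.Decidable using (dec⇒maybe)
import Tactic.RingSolver.Core.AlmostCommutativeRing as ACR
open import Tactic.RingSolver using (solve-∀; solve)

open import Algebra.Properties.Semiring.Sum (CommutativeRing.semiring ℚP.+-*-commutativeRing)
  using (sum; sum-cong-≗; ∑-distrib-+; ∑-comm; *-distribˡ-sum; sum-replicate-zero)

ℚ-ring : ACR.AlmostCommutativeRing 0ℓ 0ℓ
ℚ-ring = ACR.fromCommutativeRing ℚP.+-*-commutativeRing (λ x → dec⇒maybe (0ℚ ℚP.≟ x))

ι : ℕ → ℚ
ι n = + n / 1

ι-+ : ∀ m n → ι (m ℕ.+ n) ≡ ι m + ι n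
ι-+ m n = ℚP.toℚᵘ-injective (begin
  ℚ.toℚᵘ (ι (m ℕ.+ n))
    ≈⟨ ℚP.toℚᵘ-fromℚᵘ _ ⟩
  mkℚᵘ (+ (m ℕ.+ n)) 0
    ≈⟨ *≡* eq ⟩
  mkℚᵘ (+ m) 0 ℚᵘ.+ mkℚᵘ (+ n) 0
    ≈⟨ ℚᵘP.+-cong (ℚP.toℚᵘ-fromℚᵘ (mkℚᵘ (+ m) 0)) (ℚP.toℚᵘ-fromℚᵘ (mkℚᵘ (+ n) 0)) ⟨
  ℚ.toℚᵘ (ι m) ℚᵘ.+ ℚ.toℚᵘ (ι n)
    ≈⟨ ℚP.toℚᵘ-homo-+ (ι m) (ι n) ⟨
  ℚ.toℚᵘ (ι m + ι n) ∎)
  where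
  open ℚᵘP.≃-Reasoning
  eq : + (m ℕ.+ n) ℤ.* ℚᵘ.↧ (mkℚᵘ (+ m) 0 ℚᵘ.+ mkℚᵘ (+ n) 0)
     ≡ ℚᵘ.↥ (mkℚᵘ (+ m) 0 ℚᵘ.+ mkℚᵘ (+ n) 0) ℤ.* ℚᵘ.↧ (mkℚᵘ (+ (m ℕ.+ n)) 0)
  eq = cong (ℤ._* + 1) (trans (ℤP.pos-+ m n) (sym (cong₂ ℤ._+_ (ℤP.*-identityʳ (+ m)) (ℤP.*-identityʳ (+ n)))))

ι-suc : ∀ m → ι (suc m) ≡ 1ℚ + ι m
ι-suc = ι-+ 1

2n≡n+n : ∀ n → + (2 ℕ.* n) / 1 ≡ ι n + ι n
2n≡n+n n = trans (ι-+ n (n ℕ.+ 0)) (cong (λ k → ι n + ι k) (ℕP.+-identityʳ n))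

ι*recip : ∀ m → ι (suc m) * recip (suc m) ≡ 1ℚ
ι*recip m = ℚP.toℚᵘ-injective (begin
  ℚ.toℚᵘ (ι (suc m) * recip (suc m))
    ≈⟨ ℚP.toℚᵘ-homo-* (ι (suc m)) (recip (suc m)) ⟩
  ℚ.toℚᵘ (ι (suc m)) ℚᵘ.* ℚ.toℚᵘ (recip (suc m))
    ≈⟨ ℚᵘP.*-cong (ℚP.toℚᵘ-fromℚᵘ (mkℚᵘ (+ suc m) 0)) (ℚP.toℚᵘ-fromℚᵘ (mkℚᵘ (+ 1) m)) ⟩
  mkℚᵘ (+ suc m) 0 ℚᵘ.* mkℚᵘ (+ 1) m
    ≈⟨ *≡* (cong (λ k → + suc k) (ℕ-Ring.solve (m ∷ []))) ⟩
  ℚ.toℚᵘ 1ℚ ∎)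
  where open ℚᵘP.≃-Reasoning

open ≡-Reasoning

sumFin≡sum : ∀ {k} (f : Fin k → ℚ) → sumFin k f ≡ sum f
sumFin≡sum {zero}  f = refl
sumFin≡sum {suc k} f = cong (_+_ (f zero)) (sumFin≡sum (λ i → f (suc i)))

sumFin-cong : ∀ k {f g : Fin k → ℚ} → (∀ i → f i ≡ g i) → sumFin k f ≡ sumFin k g
sumFin-cong k {f} {g} f≗g = begin
  sumFin k f ≡⟨ sumFin≡sum f ⟩
  sum f      ≡⟨ sum-cong-≗ f≗g ⟩
  sum g      ≡⟨ sumFin≡sum g ⟨
  sumFin k g ∎

sumFin-+ : ∀ k (f g : Fin k → ℚ) → sumFin k (λ i → f i + g i) ≡ sumFin k f + sumFin k g
sumFin-+ k f g = begin
  sumFin k (λ i → f i + g i) ≡⟨ sumFin≡sum (λ i → f i + g i) ⟩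
  sum (λ i → f i + g i)      ≡⟨ ∑-distrib-+ f g ⟩
  sum f + sum g              ≡⟨ cong₂ _+_ (sumFin≡sum f) (sumFin≡sum g) ⟨
  sumFin k f + sumFin k g    ∎

sumFin-*ˡ : ∀ k c (f : Fin k → ℚ) → sumFin k (λ i → c * f i) ≡ c * sumFin k f
sumFin-*ˡ k c f = begin
  sumFin k (λ i → c * f i) ≡⟨ sumFin≡sum (λ i → c * f i) ⟩
  sum (λ i → c * f i)      ≡⟨ *-distribˡ-sum c f ⟨
  c * sum f                ≡⟨ cong (c *_) (sumFin≡sum f) ⟨
  c * sumFin k f           ∎

sumFin-*ʳ : ∀ k c (f : Fin k → ℚ) → sumFin k (λ i → f i * c) ≡ sumFin k f * c
sumFin-*ʳ k c f = begin
  sumFin k (λ i → f i * c) ≡⟨ sumFin-cong k (λ i → ℚP.*-comm (f i) c) ⟩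
  sumFin k (λ i → c * f i) ≡⟨ sumFin-*ˡ k c f ⟩
  c * sumFin k f           ≡⟨ ℚP.*-comm c _ ⟩
  sumFin k f * c           ∎

sumFin-swap : ∀ k l (F : Fin k → Fin l → ℚ) →
  sumFin k (λ i → sumFin l (F i)) ≡ sumFin l (λ j → sumFin k (λ i → F i j))
sumFin-swap k l F = begin
  sumFin k (λ i → sumFin l (F i))           ≡⟨ sumFin≡sum (λ i → sumFin l (F i)) ⟩
  sum (λ i → sumFin l (F i))                ≡⟨ sum-cong-≗ (λ i → sumFin≡sum (F i)) ⟩
  sum (λ i → sum (F i))                     ≡⟨ ∑-comm F ⟩
  sum (λ j → sum (λ i → F i j))             ≡⟨ sum-cong-≗ (λ j → sumFin≡sum (λ i → F i j)) ⟨
  sum (λ j → sumFin k (λ i → F i j))        ≡⟨ sumFin≡sum (λ j → sumFin k (λ i → F i j)) ⟨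
  sumFin l (λ j → sumFin k (λ i → F i j))   ∎

sumFin-0 : ∀ k → sumFin k (λ _ → 0ℚ) ≡ 0ℚ
sumFin-0 k = trans (sumFin≡sum {k} (λ _ → 0ℚ)) (sum-replicate-zero k)

sumFin-const : ∀ k c → sumFin k (λ _ → c) ≡ ι k * c
sumFin-const zero    c = sym (ℚP.*-zeroˡ c)
sumFin-const (suc k) c = begin
  c + sumFin k (λ _ → c) ≡⟨ cong (_+_ c) (sumFin-const k c) ⟩
  c + ι k * c            ≡⟨ cong (_+ ι k * c) (ℚP.*-identityˡ c) ⟨
  1ℚ * c + ι k * c       ≡⟨ ℚP.*-distribʳ-+ c 1ℚ (ι k) ⟨
  (1ℚ + ι k) * c         ≡⟨ cong (_* c) (ι-suc k) ⟨
  ι (suc k) * c          ∎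

δ-sym : ∀ {k} (x y : Fin k) → δ x y ≡ δ y x
δ-sym x y with x FinP.≟ y | y FinP.≟ x
... | yes _   | yes _   = refl
... | no _    | no _    = refl
... | yes x≡y | no y≢x  = ⊥-elim (y≢x (sym x≡y))
... | no x≢y  | yes y≡x = ⊥-elim (x≢y (sym y≡x))

δ-suc : ∀ {k} (x y : Fin k) → δ (suc x) (suc y) ≡ δ x y
δ-suc x y with x FinP.≟ y
... | yes _ = refl
... | no _  = refl

sumFin-*δ : ∀ {k} (f : Fin k → ℚ) (x : Fin k) → sumFin k (λ i → f i * δ i x) ≡ f x
sumFin-*δ {suc k} f zero = begin
  f zero * 1ℚ + sumFin k (λ i → f (suc i) * 0ℚ)
    ≡⟨ cong₂ _+_ (ℚP.*-identityʳ (f zero)) (sumFin-cong k (λ i → ℚP.*-zeroʳ (f (suc i)))) ⟩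
  f zero + sumFin k (λ _ → 0ℚ)
    ≡⟨ cong (_+_ (f zero)) (sumFin-0 k) ⟩
  f zero + 0ℚ
    ≡⟨ ℚP.+-identityʳ (f zero) ⟩
  f zero ∎
sumFin-*δ {suc k} f (suc x) = begin
  f zero * 0ℚ + sumFin k (λ i → f (suc i) * δ (suc i) (suc x))
    ≡⟨ cong₂ _+_ (ℚP.*-zeroʳ (f zero)) (sumFin-cong k (λ i → cong (f (suc i) *_) (δ-suc i x))) ⟩
  0ℚ + sumFin k (λ i → f (suc i) * δ i x)
    ≡⟨ ℚP.+-identityˡ _ ⟩
  sumFin k (λ i → f (suc i) * δ i x)
    ≡⟨ sumFin-*δ (λ i → f (suc i)) x ⟩
  f (suc x) ∎

sumFin-∘δ : ∀ m (h : ℚ → ℚ) (z : Fin (suc m)) → sumFin (suc m) (λ a → h (δ a z)) ≡ h 1ℚ + ι m * h 0ℚ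
sumFin-∘δ m       h zero    = cong (_+_ (h 1ℚ)) (sumFin-const m (h 0ℚ))
sumFin-∘δ (suc m) h (suc z) = begin
  h 0ℚ + sumFin (suc m) (λ a → h (δ (suc a) (suc z)))
    ≡⟨ cong (_+_ (h 0ℚ)) (sumFin-cong (suc m) (λ a → cong h (δ-suc a z))) ⟩
  h 0ℚ + sumFin (suc m) (λ a → h (δ a z))
    ≡⟨ cong (_+_ (h 0ℚ)) (sumFin-∘δ m h z) ⟩
  h 0ℚ + (h 1ℚ + ι m * h 0ℚ)
    ≡⟨ reshuffle (h 0ℚ) (h 1ℚ) (ι m) ⟩
  h 1ℚ + (1ℚ + ι m) * h 0ℚ
    ≡⟨ cong (λ N → h 1ℚ + N * h 0ℚ) (ι-suc m) ⟨
  h 1ℚ + ι (suc m) * h 0ℚ ∎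
  where
  reshuffle : ∀ x y M → x + (y + M * x) ≡ y + (1ℚ + M) * x
  reshuffle = solve-∀ ℚ-ring

sumFin-∘δ′ : ∀ m (h : ℚ → ℚ) (z : Fin (suc m)) → sumFin (suc m) (λ a → h (δ z a)) ≡ h 1ℚ + ι m * h 0ℚ
sumFin-∘δ′ m h z = trans (sumFin-cong (suc m) (λ a → cong h (δ-sym z a))) (sumFin-∘δ m h z)

∑³ : ∀ {p q r} → (Fin p × Fin q × Fin r → ℚ) → ℚ
∑³ {p} {q} {r} f = sumFin p (λ x → sumFin q (λ y → sumFin r (λ z → f (x , y , z))))

module Sum³ (p q r : ℕ) where

  ∑³-cong : {f g : Fin p × Fin q × Fin r → ℚ} → (∀ t → f t ≡ g t) → ∑³ f ≡ ∑³ g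
  ∑³-cong f≗g = sumFin-cong p (λ x → sumFin-cong q (λ y → sumFin-cong r (λ z → f≗g (x , y , z))))

  ∑³-+ : (f g : Fin p × Fin q × Fin r → ℚ) → ∑³ (λ t → f t + g t) ≡ ∑³ f + ∑³ g
  ∑³-+ f g = trans (sumFin-cong p (λ x → trans (sumFin-cong q (λ y → sumFin-+ r _ _)) (sumFin-+ q _ _))) (sumFin-+ p _ _)

  ∑³-*ˡ : ∀ c (f : Fin p × Fin q × Fin r → ℚ) → ∑³ (λ t → c * f t) ≡ c * ∑³ f
  ∑³-*ˡ c f = trans (sumFin-cong p (λ x → trans (sumFin-cong q (λ y → sumFin-*ˡ r c _)) (sumFin-*ˡ q c _))) (sumFin-*ˡ p c _)

  ∑³-*ʳ : ∀ c (f : Fin p × Fin q × Fin r → ℚ) → ∑³ (λ t → f t * c) ≡ ∑³ f * c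
  ∑³-*ʳ c f = trans (sumFin-cong p (λ x → trans (sumFin-cong q (λ y → sumFin-*ʳ r c _)) (sumFin-*ʳ q c _))) (sumFin-*ʳ p c _)

  ∑³-0 : ∑³ (λ (_ : Fin p × Fin q × Fin r) → 0ℚ) ≡ 0ℚ
  ∑³-0 = trans (sumFin-cong p (λ x → trans (sumFin-cong q (λ y → sumFin-0 r)) (sumFin-0 q))) (sumFin-0 p)

  ∑³-*δ : (f : Fin p × Fin q × Fin r → ℚ) → ∀ a b c → ∑³ (λ (x , y , z) → f (x , y , z) * (δ x a * δ y b * δ z c)) ≡ f (a , b , c)
  ∑³-*δ f a b c = begin
    ∑³ (λ (x , y , z) → f (x , y , z) * (δ x a * δ y b * δ z c))
      ≡⟨ ∑³-cong (λ (x , y , z) → split (f (x , y , z)) (δ x a) (δ y b) (δ z c)) ⟩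
    sumFin p (λ x → sumFin q (λ y → sumFin r (λ z → f (x , y , z) * δ x a * δ y b * δ z c)))
      ≡⟨ sumFin-cong p (λ x → sumFin-cong q (λ y → sumFin-*δ (λ z → f (x , y , z) * δ x a * δ y b) c)) ⟩
    sumFin p (λ x → sumFin q (λ y → f (x , y , c) * δ x a * δ y b))
      ≡⟨ sumFin-cong p (λ x → sumFin-*δ (λ y → f (x , y , c) * δ x a) b) ⟩
    sumFin p (λ x → f (x , b , c) * δ x a)
      ≡⟨ sumFin-*δ (λ x → f (x , b , c)) a ⟩
    f (a , b , c) ∎
    where
    split : ∀ w x y z → w * (x * y * z) ≡ w * x * y * z
    split = solve-∀ ℚ-ring

∑³-swap : ∀ {p q r p′ q′ r′} (F : Fin p × Fin q × Fin r → Fin p′ × Fin q′ × Fin r′ → ℚ) →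
  ∑³ (λ t → ∑³ (F t)) ≡ ∑³ (λ t′ → ∑³ (λ t → F t t′))
∑³-swap {p} {q} {r} F = begin
  ∑³ (λ t → ∑³ (F t))
    ≡⟨ sumFin-cong p (λ x → sumFin-cong q (λ y → pull r (λ z → F (x , y , z)))) ⟩
  sumFin p (λ x → sumFin q (λ y → ∑³ (λ t′ → sumFin r (λ z → F (x , y , z) t′))))
    ≡⟨ sumFin-cong p (λ x → pull q (λ y t′ → sumFin r (λ z → F (x , y , z) t′))) ⟩
  sumFin p (λ x → ∑³ (λ t′ → sumFin q (λ y → sumFin r (λ z → F (x , y , z) t′))))
    ≡⟨ pull p (λ x t′ → sumFin q (λ y → sumFin r (λ z → F (x , y , z) t′))) ⟩
  ∑³ (λ t′ → ∑³ (λ t → F t t′)) ∎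
  where
  pull : ∀ {p′ q′ r′} k (G : Fin k → Fin p′ × Fin q′ × Fin r′ → ℚ) → sumFin k (λ a → ∑³ (G a)) ≡ ∑³ (λ t′ → sumFin k (λ a → G a t′))
  pull {p′} {q′} {r′} k G =
    trans (sumFin-swap k p′ (λ a x → sumFin q′ (λ y → sumFin r′ (λ z → G a (x , y , z)))))
          (sumFin-cong p′ (λ x → trans (sumFin-swap k q′ (λ a y → sumFin r′ (λ z → G a (x , y , z))))
                                    (sumFin-cong q′ (λ y → sumFin-swap k r′ (λ a z → G a (x , y , z))))))

module _ {n : ℕ} where

  open Sum³ 3 n n

  infix 4 _≈ₘ_

  _≈ₘ_ : EMat n → EMat n → Set
  X ≈ₘ Y = ∀ e f → X e f ≡ Y e f

  Symmetric : EMat n → Set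
  Symmetric X = ∀ e f → X e f ≡ X f e

  0ₘ : EMat n
  0ₘ _ _ = 0ℚ

  _⊕[_]_ : EMat n → ℚ → EMat n → EMat n
  (X ⊕[ c ] Y) e f = X e f + c * Y e f

  ·-congˡ : ∀ {Y Z} (X : EMat n) → Y ≈ₘ Z → Y · X ≈ₘ Z · X
  ·-congˡ X Y≈Z e f = ∑³-cong (λ g → cong (_* X g f) (Y≈Z e g))

  ·-congʳ : ∀ {Y Z} (X : EMat n) → Y ≈ₘ Z → X · Y ≈ₘ X · Z
  ·-congʳ X Y≈Z e f = ∑³-cong (λ g → cong (X e g *_) (Y≈Z g f))

  ·-assoc : (X Y Z : EMat n) → (X · Y) · Z ≈ₘ X · (Y · Z)
  ·-assoc X Y Z e f = begin
    sumEdge n (λ g → sumEdge n (λ h → X e h * Y h g) * Z g f)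
      ≡⟨ ∑³-cong (λ g → ∑³-*ʳ (Z g f) (λ h → X e h * Y h g)) ⟨
    sumEdge n (λ g → sumEdge n (λ h → X e h * Y h g * Z g f))
      ≡⟨ ∑³-swap (λ g h → X e h * Y h g * Z g f) ⟩
    sumEdge n (λ h → sumEdge n (λ g → X e h * Y h g * Z g f))
      ≡⟨ ∑³-cong (λ h → ∑³-cong (λ g → ℚP.*-assoc (X e h) (Y h g) (Z g f))) ⟩
    sumEdge n (λ h → sumEdge n (λ g → X e h * (Y h g * Z g f)))
      ≡⟨ ∑³-cong (λ h → ∑³-*ˡ (X e h) (λ g → Y h g * Z g f)) ⟩
    sumEdge n (λ h → X e h * sumEdge n (λ g → Y h g * Z g f)) ∎

  ·-identityʳ : (X : EMat n) → X · Id n ≈ₘ X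
  ·-identityʳ X e (c , i , j) = begin
    sumEdge n (λ (c′ , i′ , j′) → X e (c′ , i′ , j′) * (δ c′ c * δ i′ i * δ j′ j)) ≡⟨ ∑³-*δ (X e) c i j ⟩
    X e (c , i , j)                                                               ∎

  ·-identityˡ : (X : EMat n) → Id n · X ≈ₘ X
  ·-identityˡ X (c , i , j) f = begin
    sumEdge n (λ (c′ , i′ , j′) → δ c c′ * δ i i′ * δ j j′ * X (c′ , i′ , j′) f)
      ≡⟨ ∑³-cong (λ (c′ , i′ , j′) → flip (δ c c′) (δ i i′) (δ j j′) (X (c′ , i′ , j′) f)) ⟩
    sumEdge n (λ (c′ , i′ , j′) → X (c′ , i′ , j′) f * (δ c c′ * δ i i′ * δ j j′))
      ≡⟨ ∑³-cong (λ (c′ , i′ , j′) → cong (X (c′ , i′ , j′) f *_) (cong₂ _*_ (cong₂ _*_ (δ-sym c c′) (δ-sym i i′)) (δ-sym j j′))) ⟩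
    sumEdge n (λ (c′ , i′ , j′) → X (c′ , i′ , j′) f * (δ c′ c * δ i′ i * δ j′ j))
      ≡⟨ ∑³-*δ (λ g → X g f) c i j ⟩
    X (c , i , j) f ∎
    where
    flip : ∀ x y z w → x * y * z * w ≡ w * (x * y * z)
    flip = solve-∀ ℚ-ring

  ·-distribʳ : (X Y Z : EMat n) (c : ℚ) → (X ⊕[ c ] Y) · Z ≈ₘ (X · Z) ⊕[ c ] (Y · Z)
  ·-distribʳ X Y Z c e f = begin
    sumEdge n (λ g → (X e g + c * Y e g) * Z g f)               ≡⟨ ∑³-cong (λ g → expand (X e g) (Y e g) c (Z g f)) ⟩
    sumEdge n (λ g → X e g * Z g f + c * (Y e g * Z g f))       ≡⟨ ∑³-+ (λ g → X e g * Z g f) (λ g → c * (Y e g * Z g f)) ⟩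
    (X · Z) e f + sumEdge n (λ g → c * (Y e g * Z g f))         ≡⟨ cong (_+_ ((X · Z) e f)) (∑³-*ˡ c (λ g → Y e g * Z g f)) ⟩
    (X · Z) e f + c * (Y · Z) e f                               ∎
    where
    expand : ∀ x y c z → (x + c * y) * z ≡ x * z + c * (y * z)
    expand = solve-∀ ℚ-ring

  ·-distribˡ : (X Y Z : EMat n) (c : ℚ) → Z · (X ⊕[ c ] Y) ≈ₘ (Z · X) ⊕[ c ] (Z · Y)
  ·-distribˡ X Y Z c e f = begin
    sumEdge n (λ g → Z e g * (X g f + c * Y g f))               ≡⟨ ∑³-cong (λ g → expand (X g f) (Y g f) c (Z e g)) ⟩
    sumEdge n (λ g → Z e g * X g f + c * (Z e g * Y g f))       ≡⟨ ∑³-+ (λ g → Z e g * X g f) (λ g → c * (Z e g * Y g f)) ⟩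
    (Z · X) e f + sumEdge n (λ g → c * (Z e g * Y g f))         ≡⟨ cong (_+_ ((Z · X) e f)) (∑³-*ˡ c (λ g → Z e g * Y g f)) ⟩
    (Z · X) e f + c * (Z · Y) e f                               ∎
    where
    expand : ∀ x y c z → z * (x + c * y) ≡ z * x + c * (z * y)
    expand = solve-∀ ℚ-ring

  ·-zeroˡ : ∀ {Y} (X : EMat n) → Y ≈ₘ 0ₘ → Y · X ≈ₘ 0ₘ
  ·-zeroˡ X Y≈0 e f = trans (∑³-cong (λ g → trans (cong (_* X g f) (Y≈0 e g)) (ℚP.*-zeroˡ (X g f)))) ∑³-0

  ·-transpose : ∀ {X Y} → Symmetric X → Symmetric Y → ∀ e f → (X · Y) e f ≡ (Y · X) f e
  ·-transpose {X} {Y} X-sym Y-sym e f = ∑³-cong (λ g → trans (cong₂ _*_ (X-sym e g) (Y-sym g f)) (ℚP.*-comm (X g e) (Y f g)))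

  Id-symmetric : Symmetric (Id n)
  Id-symmetric (c , i , j) (c′ , i′ , j′) = cong₂ _*_ (cong₂ _*_ (δ-sym c c′) (δ-sym i i′)) (δ-sym j j′)

  ⊕-symmetric : ∀ {X Y} (c : ℚ) → Symmetric X → Symmetric Y → Symmetric (X ⊕[ c ] Y)
  ⊕-symmetric c X-sym Y-sym e f = cong₂ _+_ (X-sym e f) (cong (c *_) (Y-sym e f))

  inverse-unique : ∀ {A B B′ : EMat n} → A · B′ ≈ₘ Id n → B · A ≈ₘ Id n → B ≈ₘ B′
  inverse-unique {A} {B} {B′} AB′≈I BA≈I e f = begin
    B e f                 ≡⟨ ·-identityʳ B e f ⟨
    (B · Id n) e f        ≡⟨ ·-congʳ B AB′≈I e f ⟨
    (B · (A · B′)) e f    ≡⟨ ·-assoc B A B′ e f ⟨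
    ((B · A) · B′) e f    ≡⟨ ·-congˡ B′ BA≈I e f ⟩
    (Id n · B′) e f       ≡⟨ ·-identityˡ B′ e f ⟩
    B′ e f                ∎

module OrthogonalProjection {n : ℕ} {N K : EMat n} (N-sym : Symmetric N) (K-proj : IsOrthProjOntoKer N K) where
  open IsOrthProjOntoKer K-proj

  N·K≈0 : N · K ≈ₘ 0ₘ
  N·K≈0 e f = begin
    (N · K) e f           ≡⟨ ·-congʳ N (λ g h → ·-identityʳ K g h) e f ⟨
    (N · (K · Id n)) e f  ≡⟨ image⊆ker (λ h → Id n h f) e ⟩
    0ℚ                    ∎

  K·N≈0 : K · N ≈ₘ 0ₘ
  K·N≈0 e f = trans (·-transpose symmetric N-sym e f) (N·K≈0 f e)

  K≈P : ∀ {P B} → Symmetric P → N · P ≈ₘ 0ₘ → Symmetric (N · B) → Id n ≈ₘ P ⊕[ 1ℚ ] (N · B) → K ≈ₘ P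
  K≈P {P} {B} P-sym N·P≈0 NB-sym I≈P+NB e f = begin
    K e f          ≡⟨ symmetric e f ⟩
    K f e          ≡⟨ P·K≈K f e ⟨
    (P · K) f e    ≡⟨ ·-transpose P-sym symmetric f e ⟩
    (K · P) e f    ≡⟨ ker⊆image (λ g → P g f) (λ g → N·P≈0 g f) e ⟩
    P e f          ∎
    where
    NB·K≈0 : (N · B) · K ≈ₘ 0ₘ
    NB·K≈0 e f = begin
      ((N · B) · K) e f ≡⟨ ·-transpose NB-sym symmetric e f ⟩
      (K · (N · B)) f e ≡⟨ ·-assoc K N B f e ⟨
      ((K · N) · B) f e ≡⟨ ·-zeroˡ B K·N≈0 f e ⟩
      0ℚ                ∎

    P·K≈K : P · K ≈ₘ K
    P·K≈K e f = sym (begin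
      K e f                                       ≡⟨ ·-identityˡ K e f ⟨
      (Id n · K) e f                              ≡⟨ ·-congˡ K I≈P+NB e f ⟩
      ((P ⊕[ 1ℚ ] (N · B)) · K) e f               ≡⟨ ·-distribʳ P (N · B) K 1ℚ e f ⟩
      (P · K) e f + 1ℚ * ((N · B) · K) e f        ≡⟨ cong (λ x → (P · K) e f + 1ℚ * x) (NB·K≈0 e f) ⟩
      (P · K) e f + 1ℚ * 0ℚ                       ≡⟨ ℚP.+-identityʳ _ ⟩
      (P · K) e f ∎)

  N⊕K-inverse : ∀ {B Z} (c d : ℚ) → c * d ≡ 1ℚ → Symmetric B → Id n ≈ₘ K ⊕[ 1ℚ ] (N · B) → B ≈ₘ (N · Z) ⊕[ d ] Id n →
    IsInverse (N ⊕[ c ] K) B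
  N⊕K-inverse {B} {Z} c d cd≡1 B-sym I≈K+NB B≈NZ+dI = AB≈I , BA≈I
    where
    K·B≈dK : ∀ e f → (K · B) e f ≡ d * K e f
    K·B≈dK e f = begin
      (K · B) e f                                  ≡⟨ ·-congʳ K B≈NZ+dI e f ⟩
      (K · ((N · Z) ⊕[ d ] Id n)) e f              ≡⟨ ·-distribˡ (N · Z) (Id n) K d e f ⟩
      (K · (N · Z)) e f + d * (K · Id n) e f
        ≡⟨ cong₂ (λ x y → x + d * y) (trans (sym (·-assoc K N Z e f)) (·-zeroˡ Z K·N≈0 e f)) (·-identityʳ K e f) ⟩
      0ℚ + d * K e f                               ≡⟨ ℚP.+-identityˡ _ ⟩
      d * K e f                                    ∎

    swap-+1* : ∀ x y → x + 1ℚ * y ≡ y + 1ℚ * x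
    swap-+1* = solve-∀ ℚ-ring

    AB≈I : (N ⊕[ c ] K) · B ≈ₘ Id n
    AB≈I e f = begin
      ((N ⊕[ c ] K) · B) e f         ≡⟨ ·-distribʳ N K B c e f ⟩
      (N · B) e f + c * (K · B) e f  ≡⟨ cong (λ x → (N · B) e f + c * x) (K·B≈dK e f) ⟩
      (N · B) e f + c * (d * K e f)  ≡⟨ cong (_+_ ((N · B) e f)) (ℚP.*-assoc c d (K e f)) ⟨
      (N · B) e f + c * d * K e f    ≡⟨ cong (λ w → (N · B) e f + w * K e f) cd≡1 ⟩
      (N · B) e f + 1ℚ * K e f       ≡⟨ swap-+1* ((N · B) e f) (K e f) ⟩
      K e f + 1ℚ * (N · B) e f       ≡⟨ I≈K+NB e f ⟨
      Id n e f                       ∎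

    BA≈I : B · (N ⊕[ c ] K) ≈ₘ Id n
    BA≈I e f = begin
      (B · (N ⊕[ c ] K)) e f   ≡⟨ ·-transpose B-sym (⊕-symmetric c N-sym symmetric) e f ⟩
      ((N ⊕[ c ] K) · B) f e   ≡⟨ AB≈I f e ⟩
      Id n f e                 ≡⟨ Id-symmetric f e ⟩
      Id n e f                 ∎

sumFin²-δ : ∀ {n} (F : Fin n → Fin n → ℚ) b c → sumFin n (λ i → sumFin n (λ j → δ i b * δ j c * F i j)) ≡ F b c
sumFin²-δ {n} F b c = begin
  sumFin n (λ i → sumFin n (λ j → δ i b * δ j c * F i j))
    ≡⟨ sumFin-cong n (λ i → sumFin-cong n (λ j → shuffle (δ i b) (δ j c) (F i j))) ⟩
  sumFin n (λ i → sumFin n (λ j → F i j * δ i b * δ j c))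
    ≡⟨ sumFin-cong n (λ i → sumFin-*δ (λ j → F i j * δ i b) c) ⟩
  sumFin n (λ i → F i c * δ i b)
    ≡⟨ sumFin-*δ (λ i → F i c) b ⟩
  F b c ∎
  where
  shuffle : ∀ x y z → x * y * z ≡ z * x * y
  shuffle = solve-∀ ℚ-ring

sumFin²-δ′ : ∀ {n} (F : Fin n → Fin n → ℚ) b c → sumFin n (λ i → sumFin n (λ j → δ b i * δ c j * F i j)) ≡ F b c
sumFin²-δ′ {n} F b c =
  trans (sumFin-cong n (λ i → sumFin-cong n (λ j → cong (_* F i j) (cong₂ _*_ (δ-sym b i) (δ-sym c j)))))
        (sumFin²-δ F b c)

-- The two further edges of the triangle spanned by an edge and a vertex a of the part it misses.
side₁ side₂ : ∀ {n} → Edge n → Fin n → Edge n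
side₁ (zero           , i , j) a = suc zero , a , j
side₁ (suc zero       , i , j) a = zero , a , j
side₁ (suc (suc zero) , i , j) a = zero , j , a
side₂ (zero           , i , j) a = suc (suc zero) , a , i
side₂ (suc zero       , i , j) a = suc (suc zero) , i , a
side₂ (suc (suc zero) , i , j) a = suc zero , i , a

sum-over-triangle : ∀ n (x : Edge n → ℚ) a b c →
  sumEdge n (λ g → W n g (a , b , c) * x g) ≡ x (zero , b , c) + (x (suc zero , a , c) + (x (suc (suc zero) , a , b) + 0ℚ))
sum-over-triangle n x a b c =
  cong₂ _+_ (sumFin²-δ (λ i j → x (zero , i , j)) b c)
    (cong₂ _+_ (sumFin²-δ (λ i j → x (suc zero , i , j)) a c)
      (cong (_+ 0ℚ) (sumFin²-δ (λ i j → x (suc (suc zero) , i , j)) a b)))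

M-column : ∀ n (X : EMat n) e f → (M n · X) e f ≡ sumTri n (λ t → W n e t * sumEdge n (λ g → W n g t * X g f))
M-column n X e f = begin
  sumEdge n (λ g → sumTri n (λ t → W n e t * W n g t) * X g f)
    ≡⟨ E.∑³-cong (λ g → T.∑³-*ʳ (X g f) (λ t → W n e t * W n g t)) ⟨
  sumEdge n (λ g → sumTri n (λ t → W n e t * W n g t * X g f))
    ≡⟨ ∑³-swap (λ g t → W n e t * W n g t * X g f) ⟩
  sumTri n (λ t → sumEdge n (λ g → W n e t * W n g t * X g f))
    ≡⟨ T.∑³-cong (λ t → E.∑³-cong (λ g → ℚP.*-assoc (W n e t) (W n g t) (X g f))) ⟩
  sumTri n (λ t → sumEdge n (λ g → W n e t * (W n g t * X g f)))
    ≡⟨ T.∑³-cong (λ t → E.∑³-*ˡ (W n e t) (λ g → W n g t * X g f)) ⟩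
  sumTri n (λ t → W n e t * sumEdge n (λ g → W n g t * X g f)) ∎
  where
  module E = Sum³ 3 n n
  module T = Sum³ n n n

M-apply : ∀ n (X : EMat n) e f → (M n · X) e f ≡ sumFin n (λ a → X e f + (X (side₁ e a) f + X (side₂ e a) f))
M-apply n X e@(zero , i , j) f = begin
  (M n · X) e f
    ≡⟨ M-column n X e f ⟩
  sumFin n (λ a → sumFin n (λ b → sumFin n (λ c → δ i b * δ j c * T (a , b , c))))
    ≡⟨ sumFin-cong n (λ a → sumFin²-δ′ (λ b c → T (a , b , c)) i j) ⟩
  sumFin n (λ a → T (a , i , j))
    ≡⟨ sumFin-cong n (λ a → sum-over-triangle n (λ g → X g f) a i j) ⟩
  sumFin n (λ a → X e f + (X (suc zero , a , j) f + (X (suc (suc zero) , a , i) f + 0ℚ)))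
    ≡⟨ sumFin-cong n (λ a → reorder (X e f) (X (side₁ e a) f) (X (side₂ e a) f)) ⟩
  sumFin n (λ a → X e f + (X (side₁ e a) f + X (side₂ e a) f)) ∎
  where
  T : Triangle n → ℚ
  T t = sumEdge n (λ g → W n g t * X g f)
  reorder : ∀ p q r → p + (q + (r + 0ℚ)) ≡ p + (q + r)
  reorder = solve-∀ ℚ-ring
M-apply n X e@(suc zero , i , j) f = begin
  (M n · X) e f
    ≡⟨ M-column n X e f ⟩
  sumFin n (λ a → sumFin n (λ b → sumFin n (λ c → δ i a * δ j c * T (a , b , c))))
    ≡⟨ sumFin-swap n n (λ a b → sumFin n (λ c → δ i a * δ j c * T (a , b , c))) ⟩
  sumFin n (λ b → sumFin n (λ a → sumFin n (λ c → δ i a * δ j c * T (a , b , c))))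
    ≡⟨ sumFin-cong n (λ b → sumFin²-δ′ (λ a c → T (a , b , c)) i j) ⟩
  sumFin n (λ b → T (i , b , j))
    ≡⟨ sumFin-cong n (λ b → sum-over-triangle n (λ g → X g f) i b j) ⟩
  sumFin n (λ b → X (zero , b , j) f + (X e f + (X (suc (suc zero) , i , b) f + 0ℚ)))
    ≡⟨ sumFin-cong n (λ b → reorder (X e f) (X (side₁ e b) f) (X (side₂ e b) f)) ⟩
  sumFin n (λ b → X e f + (X (side₁ e b) f + X (side₂ e b) f)) ∎
  where
  T : Triangle n → ℚ
  T t = sumEdge n (λ g → W n g t * X g f)
  reorder : ∀ p q r → q + (p + (r + 0ℚ)) ≡ p + (q + r)
  reorder = solve-∀ ℚ-ring
M-apply n X e@(suc (suc zero) , i , j) f = begin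
  (M n · X) e f
    ≡⟨ M-column n X e f ⟩
  sumFin n (λ a → sumFin n (λ b → sumFin n (λ c → δ i a * δ j b * T (a , b , c))))
    ≡⟨ sumFin-cong n (λ a → sumFin-cong n (λ b → sumFin-*ˡ n (δ i a * δ j b) (λ c → T (a , b , c)))) ⟩
  sumFin n (λ a → sumFin n (λ b → δ i a * δ j b * sumFin n (λ c → T (a , b , c))))
    ≡⟨ sumFin²-δ′ (λ a b → sumFin n (λ c → T (a , b , c))) i j ⟩
  sumFin n (λ c → T (i , j , c))
    ≡⟨ sumFin-cong n (λ c → sum-over-triangle n (λ g → X g f) i j c) ⟩
  sumFin n (λ c → X (zero , j , c) f + (X (suc zero , i , c) f + (X e f + 0ℚ)))
    ≡⟨ sumFin-cong n (λ c → reorder (X e f) (X (side₁ e c) f) (X (side₂ e c) f)) ⟩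
  sumFin n (λ c → X e f + (X (side₁ e c) f + X (side₂ e c) f)) ∎
  where
  T : Triangle n → ℚ
  T t = sumEdge n (λ g → W n g t * X g f)
  reorder : ∀ p q r → q + (r + (p + 0ℚ)) ≡ p + (q + r)
  reorder = solve-∀ ℚ-ring

M-symmetric : ∀ n → Symmetric (M n)
M-symmetric n e f = Sum³.∑³-cong n n n (λ t → ℚP.*-comm (W n e t) (W n f t))

-- Edges of the same class are compared coordinatewise; edges of different classes share exactly one
-- part and are compared there. The arguments are the δ-values of these comparisons.
data Meeting : Set where
  sameParts : ℚ → ℚ → Meeting
  onePart   : ℚ → Meeting

meet : ∀ {n} → Edge n → Edge n → Meeting
meet (zero           , i , j) (zero           , i′ , j′) = sameParts (δ i i′) (δ j j′)
meet (zero           , i , j) (suc zero       , i′ , j′) = onePart (δ j j′)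
meet (zero           , i , j) (suc (suc zero) , i′ , j′) = onePart (δ i j′)
meet (suc zero       , i , j) (zero           , i′ , j′) = onePart (δ j j′)
meet (suc zero       , i , j) (suc zero       , i′ , j′) = sameParts (δ i i′) (δ j j′)
meet (suc zero       , i , j) (suc (suc zero) , i′ , j′) = onePart (δ i i′)
meet (suc (suc zero) , i , j) (zero           , i′ , j′) = onePart (δ j i′)
meet (suc (suc zero) , i , j) (suc zero       , i′ , j′) = onePart (δ i i′)
meet (suc (suc zero) , i , j) (suc (suc zero) , i′ , j′) = sameParts (δ i i′) (δ j j′)

meet-sym : ∀ {n} (e f : Edge n) → meet e f ≡ meet f e
meet-sym (zero           , i , j) (zero           , i′ , j′) = cong₂ sameParts (δ-sym i i′) (δ-sym j j′)
meet-sym (zero           , i , j) (suc zero       , i′ , j′) = cong onePart (δ-sym j j′)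
meet-sym (zero           , i , j) (suc (suc zero) , i′ , j′) = cong onePart (δ-sym i j′)
meet-sym (suc zero       , i , j) (zero           , i′ , j′) = cong onePart (δ-sym j j′)
meet-sym (suc zero       , i , j) (suc zero       , i′ , j′) = cong₂ sameParts (δ-sym i i′) (δ-sym j j′)
meet-sym (suc zero       , i , j) (suc (suc zero) , i′ , j′) = cong onePart (δ-sym i i′)
meet-sym (suc (suc zero) , i , j) (zero           , i′ , j′) = cong onePart (δ-sym j i′)
meet-sym (suc (suc zero) , i , j) (suc zero       , i′ , j′) = cong onePart (δ-sym i i′)
meet-sym (suc (suc zero) , i , j) (suc (suc zero) , i′ , j′) = cong₂ sameParts (δ-sym i i′) (δ-sym j j′)

data Coeffs : Set where
  coeffs : (a b c p q : ℚ) → Coeffs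

entry : Coeffs → Meeting → ℚ
entry (coeffs a b c p q) (sameParts x y) = a * (x * y) + b * (x + y) + c
entry (coeffs a b c p q) (onePart x)     = p * x + q

scheme : ∀ {n} → Coeffs → EMat n
scheme C e f = entry C (meet e f)

scheme-symmetric : ∀ {n} (C : Coeffs) → Symmetric (scheme {n} C)
scheme-symmetric C e f = cong (entry C) (meet-sym e f)

_⊕ᶜ[_]_ : Coeffs → ℚ → Coeffs → Coeffs
coeffs a b c p q ⊕ᶜ[ k ] coeffs a′ b′ c′ p′ q′ = coeffs (a + k * a′) (b + k * b′) (c + k * c′) (p + k * p′) (q + k * q′)

0ᶜ 1ᶜ : Coeffs
0ᶜ = coeffs 0ℚ 0ℚ 0ℚ 0ℚ 0ℚ
1ᶜ = coeffs 1ℚ 0ℚ 0ℚ 0ℚ 0ℚ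

entry-⊕ : ∀ C k D ω → entry (C ⊕ᶜ[ k ] D) ω ≡ entry C ω + k * entry D ω
entry-⊕ (coeffs a b c p q) k (coeffs a′ b′ c′ p′ q′) (sameParts x y) = lin a b c a′ b′ c′ k x y
  where
  lin : ∀ a b c a′ b′ c′ k x y →
    (a + k * a′) * (x * y) + (b + k * b′) * (x + y) + (c + k * c′) ≡ (a * (x * y) + b * (x + y) + c) + k * (a′ * (x * y) + b′ * (x + y) + c′)
  lin = solve-∀ ℚ-ring
entry-⊕ (coeffs a b c p q) k (coeffs a′ b′ c′ p′ q′) (onePart x) = lin p q p′ q′ k x
  where
  lin : ∀ p q p′ q′ k x → (p + k * p′) * x + (q + k * q′) ≡ (p * x + q) + k * (p′ * x + q′)
  lin = solve-∀ ℚ-ring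

entry-0 : ∀ ω → entry 0ᶜ ω ≡ 0ℚ
entry-0 (sameParts x y) = zero-poly x y
  where
  zero-poly : ∀ x y → 0ℚ * (x * y) + 0ℚ * (x + y) + 0ℚ ≡ 0ℚ
  zero-poly = solve-∀ ℚ-ring
entry-0 (onePart x)     = zero-poly x
  where
  zero-poly : ∀ x → 0ℚ * x + 0ℚ ≡ 0ℚ
  zero-poly = solve-∀ ℚ-ring

scheme-⊕ : ∀ {n} C k D → scheme {n} (C ⊕ᶜ[ k ] D) ≈ₘ scheme C ⊕[ k ] scheme D
scheme-⊕ C k D e f = entry-⊕ C k D (meet e f)

scheme-0 : ∀ {n} → scheme {n} 0ᶜ ≈ₘ 0ₘ
scheme-0 e f = entry-0 (meet e f)

private
  Id-sameParts : ∀ x y → 1ℚ * x * y ≡ 1ℚ * (x * y) + 0ℚ * (x + y) + 0ℚ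
  Id-sameParts = solve-∀ ℚ-ring
  Id-onePart : ∀ x y z → 0ℚ * x * y ≡ 0ℚ * z + 0ℚ
  Id-onePart = solve-∀ ℚ-ring

Id≈scheme-1 : ∀ {n} → Id n ≈ₘ scheme 1ᶜ
Id≈scheme-1 (zero           , i , j) (zero           , i′ , j′) = Id-sameParts (δ i i′) (δ j j′)
Id≈scheme-1 (zero           , i , j) (suc zero       , i′ , j′) = Id-onePart (δ i i′) (δ j j′) (δ j j′)
Id≈scheme-1 (zero           , i , j) (suc (suc zero) , i′ , j′) = Id-onePart (δ i i′) (δ j j′) (δ i j′)
Id≈scheme-1 (suc zero       , i , j) (zero           , i′ , j′) = Id-onePart (δ i i′) (δ j j′) (δ j j′)
Id≈scheme-1 (suc zero       , i , j) (suc zero       , i′ , j′) = Id-sameParts (δ i i′) (δ j j′)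
Id≈scheme-1 (suc zero       , i , j) (suc (suc zero) , i′ , j′) = Id-onePart (δ i i′) (δ j j′) (δ i i′)
Id≈scheme-1 (suc (suc zero) , i , j) (zero           , i′ , j′) = Id-onePart (δ i i′) (δ j j′) (δ j i′)
Id≈scheme-1 (suc (suc zero) , i , j) (suc zero       , i′ , j′) = Id-onePart (δ i i′) (δ j j′) (δ i i′)
Id≈scheme-1 (suc (suc zero) , i , j) (suc (suc zero) , i′ , j′) = Id-sameParts (δ i i′) (δ j j′)

-- The coefficients of M · scheme C when every part has N vertices.
M-action : ℚ → Coeffs → Coeffs
M-action N (coeffs a b c p q) = coeffs (N * a) (N * b + N * p) (N * c + (N * q + N * q)) (N * p + a + N * b) ((N * q + N * q) + b + N * c + p)

sameParts-sum : ∀ m C x y →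
  sumFin (suc m) (λ _ → entry C (sameParts x y) + (entry C (onePart y) + entry C (onePart x))) ≡ entry (M-action (ι (suc m)) C) (sameParts x y)
sameParts-sum m (coeffs a b c p q) x y = trans (sumFin-const (suc m) _) (poly (ι (suc m)) a b c p q x y)
  where
  poly : ∀ N a b c p q x y → N * ((a * (x * y) + b * (x + y) + c) + ((p * y + q) + (p * x + q)))
                           ≡ N * a * (x * y) + (N * b + N * p) * (x + y) + (N * c + (N * q + N * q))
  poly = solve-∀ ℚ-ring

onePart-sum : ∀ m C y z →
  sumFin (suc m) (λ v → entry C (onePart y) + (entry C (sameParts (δ v z) y) + entry C (onePart (δ v z)))) ≡ entry (M-action (ι (suc m)) C) (onePart y)
onePart-sum m C@(coeffs a b c p q) y z = begin
  sumFin (suc m) (λ v → h (δ v z))            ≡⟨ sumFin-∘δ m h z ⟩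
  h 1ℚ + ι m * h 0ℚ                           ≡⟨ poly (ι m) a b c p q y ⟩
  entry (M-action (1ℚ + ι m) C) (onePart y)   ≡⟨ cong (λ N → entry (M-action N C) (onePart y)) (ι-suc m) ⟨
  entry (M-action (ι (suc m)) C) (onePart y)  ∎
  where
  h : ℚ → ℚ
  h d = entry C (onePart y) + (entry C (sameParts d y) + entry C (onePart d))
  poly : ∀ M a b c p q y →
    ((p * y + q) + ((a * (1ℚ * y) + b * (1ℚ + y) + c) + (p * 1ℚ + q))) + M * ((p * y + q) + ((a * (0ℚ * y) + b * (0ℚ + y) + c) + (p * 0ℚ + q)))
      ≡ ((1ℚ + M) * p + a + (1ℚ + M) * b) * y + (((1ℚ + M) * q + (1ℚ + M) * q) + b + (1ℚ + M) * c + p)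
  poly = solve-∀ ℚ-ring

sameParts-comm : ∀ C x y → entry C (sameParts x y) ≡ entry C (sameParts y x)
sameParts-comm (coeffs a b c p q) x y = poly a b c x y
  where
  poly : ∀ a b c x y → a * (x * y) + b * (x + y) + c ≡ a * (y * x) + b * (y + x) + c
  poly = solve-∀ ℚ-ring

M·scheme : ∀ m C → M (suc m) · scheme C ≈ₘ scheme (M-action (ι (suc m)) C)
M·scheme m C e f = trans (M-apply (suc m) (scheme C) e f) (triangle-sum e f)
  where
  SP : ℚ → ℚ → ℚ
  SP x y = entry C (sameParts x y)
  CP : ℚ → ℚ
  CP x = entry C (onePart x)
  swap : ∀ y d → CP y + (CP d + SP d y) ≡ CP y + (SP d y + CP d)
  swap y d = cong (_+_ (CP y)) (ℚP.+-comm (CP d) (SP d y))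
  flip : ∀ y d → CP y + (SP y d + CP d) ≡ CP y + (SP d y + CP d)
  flip y d = cong (λ s → CP y + (s + CP d)) (sameParts-comm C y d)
  swap-flip : ∀ y d → CP y + (CP d + SP y d) ≡ CP y + (SP d y + CP d)
  swap-flip y d = trans (cong (_+_ (CP y)) (ℚP.+-comm (CP d) (SP y d))) (flip y d)

  triangle-sum : ∀ e f → sumFin (suc m) (λ v → scheme C e f + (scheme C (side₁ e v) f + scheme C (side₂ e v) f))
                         ≡ scheme (M-action (ι (suc m)) C) e f
  triangle-sum (zero           , i , j) (zero           , i′ , j′) = sameParts-sum m C (δ i i′) (δ j j′)
  triangle-sum (zero           , i , j) (suc zero       , i′ , j′) = onePart-sum m C (δ j j′) i′
  triangle-sum (zero           , i , j) (suc (suc zero) , i′ , j′) =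
    trans (sumFin-cong (suc m) (λ v → swap (δ i j′) (δ v i′))) (onePart-sum m C (δ i j′) i′)
  triangle-sum (suc zero       , i , j) (zero           , i′ , j′) = onePart-sum m C (δ j j′) i′
  triangle-sum (suc zero       , i , j) (suc zero       , i′ , j′) = sameParts-sum m C (δ i i′) (δ j j′)
  triangle-sum (suc zero       , i , j) (suc (suc zero) , i′ , j′) =
    trans (sumFin-cong (suc m) (λ v → swap-flip (δ i i′) (δ v j′))) (onePart-sum m C (δ i i′) j′)
  triangle-sum (suc (suc zero) , i , j) (zero           , i′ , j′) =
    trans (sumFin-cong (suc m) (λ v → flip (δ j i′) (δ v j′))) (onePart-sum m C (δ j i′) j′)
  triangle-sum (suc (suc zero) , i , j) (suc zero       , i′ , j′) =
    trans (sumFin-cong (suc m) (λ v → swap-flip (δ i i′) (δ v j′))) (onePart-sum m C (δ i i′) j′)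
  triangle-sum (suc (suc zero) , i , j) (suc (suc zero) , i′ , j′) = sameParts-sum m C (δ i i′) (δ j j′)

coeffs-cong : ∀ {a b c p q a′ b′ c′ p′ q′} → a ≡ a′ → b ≡ b′ → c ≡ c′ → p ≡ p′ → q ≡ q′ →
  coeffs a b c p q ≡ coeffs a′ b′ c′ p′ q′
coeffs-cong refl refl refl refl refl = refl

-- An identity that only holds modulo t = 1 is split at an occurrence of t; on both sides of the
-- substitution the ring solver does the rest.
via : ∀ {t x y : ℚ} → t ≡ 1ℚ → (F : ℚ → ℚ) → x ≡ F t → F 1ℚ ≡ y → x ≡ y
via t≡1 F x≡F[t] F[1]≡y = trans x≡F[t] (trans (cong F t≡1) F[1]≡y)

-- For u = 1/N: B is the inverse of A, Q = M B, P = Id − Q is the projection onto ker M,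
-- and B = M Z + (u/2) Id.
module InverseCoeffs (N u : ℚ) (Nu≡1 : N * u ≡ 1ℚ) where

  Bᶜ Qᶜ Pᶜ Zᶜ : Coeffs
  Bᶜ = coeffs u (- ((+ 1 / 2) * (u * u))) ((+ 4 / 9) * (u * u * u)) 0ℚ (- ((+ 1 / 18) * (u * u * u)))
  Qᶜ = coeffs 1ℚ (- ((+ 1 / 2) * u)) ((+ 1 / 3) * (u * u)) ((+ 1 / 2) * u) (- ((+ 1 / 6) * (u * u)))
  Pᶜ = coeffs 0ℚ ((+ 1 / 2) * u) (- ((+ 1 / 3) * (u * u))) (- ((+ 1 / 2) * u)) ((+ 1 / 6) * (u * u))
  Zᶜ = coeffs ((+ 1 / 2) * (u * u)) (- ((+ 1 / 2) * (u * u * u))) ((+ 13 / 27) * (u * u * u * u)) 0ℚ (- ((+ 1 / 54) * (u * u * u * u)))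

  M-action-B : M-action N Bᶜ ≡ Qᶜ
  M-action-B = coeffs-cong
    Nu≡1
    (via Nu≡1 (λ w → - ((+ 1 / 2) * (w * u))) (solve (N ∷ u ∷ []) ℚ-ring) (solve (u ∷ []) ℚ-ring))
    (via Nu≡1 (λ w → (+ 1 / 3) * (w * (u * u))) (solve (N ∷ u ∷ []) ℚ-ring) (solve (u ∷ []) ℚ-ring))
    (via Nu≡1 (λ w → u - (+ 1 / 2) * (w * u)) (solve (N ∷ u ∷ []) ℚ-ring) (solve (u ∷ []) ℚ-ring))
    (via Nu≡1 (λ w → (+ 1 / 3) * (w * (u * u)) - (+ 1 / 2) * (u * u)) (solve (N ∷ u ∷ []) ℚ-ring) (solve (u ∷ []) ℚ-ring))

  M-action-P : M-action N Pᶜ ≡ 0ᶜ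
  M-action-P = coeffs-cong
    (solve (N ∷ []) ℚ-ring)
    (solve (N ∷ u ∷ []) ℚ-ring)
    (solve (N ∷ u ∷ []) ℚ-ring)
    (solve (N ∷ u ∷ []) ℚ-ring)
    (solve (N ∷ u ∷ []) ℚ-ring)

  M-action-Z : M-action N Zᶜ ⊕ᶜ[ (+ 1 / 2) * u ] 1ᶜ ≡ Bᶜ
  M-action-Z = coeffs-cong
    (via Nu≡1 (λ w → (+ 1 / 2) * (w * u) + (+ 1 / 2) * u) (solve (N ∷ u ∷ []) ℚ-ring) (solve (u ∷ []) ℚ-ring))
    (via Nu≡1 (λ w → - ((+ 1 / 2) * (w * (u * u)))) (solve (N ∷ u ∷ []) ℚ-ring) (solve (u ∷ []) ℚ-ring))
    (via Nu≡1 (λ w → (+ 4 / 9) * (w * (u * u * u))) (solve (N ∷ u ∷ []) ℚ-ring) (solve (u ∷ []) ℚ-ring))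
    (via Nu≡1 (λ w → (+ 1 / 2) * (u * u) - (+ 1 / 2) * (w * (u * u))) (solve (N ∷ u ∷ []) ℚ-ring) (solve (u ∷ []) ℚ-ring))
    (via Nu≡1 (λ w → (+ 4 / 9) * (w * (u * u * u)) - (+ 1 / 2) * (u * u * u)) (solve (N ∷ u ∷ []) ℚ-ring) (solve (u ∷ []) ℚ-ring))

  P⊕Q : Pᶜ ⊕ᶜ[ 1ℚ ] Qᶜ ≡ 1ᶜ
  P⊕Q = coeffs-cong
    refl
    (solve (u ∷ []) ℚ-ring)
    (solve (u ∷ []) ℚ-ring)
    (solve (u ∷ []) ℚ-ring)
    (solve (u ∷ []) ℚ-ring)

  2N*u/2≡1 : (N + N) * ((+ 1 / 2) * u) ≡ 1ℚ
  2N*u/2≡1 = via Nu≡1 (λ w → w) (solve (N ∷ u ∷ []) ℚ-ring) refl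

module ExplicitInverse (m : ℕ) where
  open InverseCoeffs (ι (suc m)) (recip (suc m)) (ι*recip m) public

  B P Q Z : EMat (suc m)
  B = scheme Bᶜ
  P = scheme Pᶜ
  Q = scheme Qᶜ
  Z = scheme Zᶜ

  M·B≈Q : M (suc m) · B ≈ₘ Q
  M·B≈Q e f = trans (M·scheme m Bᶜ e f) (cong (λ C → scheme C e f) M-action-B)

  M·P≈0 : M (suc m) · P ≈ₘ 0ₘ
  M·P≈0 e f = trans (M·scheme m Pᶜ e f) (trans (cong (λ C → scheme C e f) M-action-P) (scheme-0 e f))

  M·B-symmetric : Symmetric (M (suc m) · B)
  M·B-symmetric e f = trans (M·B≈Q e f) (trans (scheme-symmetric Qᶜ e f) (sym (M·B≈Q f e)))

  Id≈P+M·B : Id (suc m) ≈ₘ P ⊕[ 1ℚ ] (M (suc m) · B)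
  Id≈P+M·B e f = begin
    Id (suc m) e f                ≡⟨ Id≈scheme-1 e f ⟩
    scheme 1ᶜ e f                 ≡⟨ cong (λ C → scheme C e f) P⊕Q ⟨
    scheme (Pᶜ ⊕ᶜ[ 1ℚ ] Qᶜ) e f   ≡⟨ scheme-⊕ Pᶜ 1ℚ Qᶜ e f ⟩
    P e f + 1ℚ * Q e f            ≡⟨ cong (λ x → P e f + 1ℚ * x) (M·B≈Q e f) ⟨
    P e f + 1ℚ * (M (suc m) · B) e f ∎

  B≈M·Z+Id : B ≈ₘ (M (suc m) · Z) ⊕[ (+ 1 / 2) * recip (suc m) ] Id (suc m)
  B≈M·Z+Id e f = begin
    B e f                                          ≡⟨ cong (λ C → scheme C e f) M-action-Z ⟨
    scheme (M-action (ι (suc m)) Zᶜ ⊕ᶜ[ d ] 1ᶜ) e f ≡⟨ scheme-⊕ (M-action (ι (suc m)) Zᶜ) d 1ᶜ e f ⟩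
    scheme (M-action (ι (suc m)) Zᶜ) e f + d * scheme 1ᶜ e f ≡⟨ cong₂ (λ x y → x + d * y) (M·scheme m Zᶜ e f) (Id≈scheme-1 e f) ⟨
    (M (suc m) · Z) e f + d * Id (suc m) e f        ∎
    where
    d : ℚ
    d = (+ 1 / 2) * recip (suc m)

  module _ {K : EMat (suc m)} (K-proj : IsOrthProjOntoKer (M (suc m)) K) where
    open OrthogonalProjection (M-symmetric (suc m)) K-proj

    Id≈K+M·B : Id (suc m) ≈ₘ K ⊕[ 1ℚ ] (M (suc m) · B)
    Id≈K+M·B e f = trans (Id≈P+M·B e f) (cong (λ x → x + 1ℚ * (M (suc m) · B) e f)
      (sym (K≈P {P} {B} (scheme-symmetric Pᶜ) M·P≈0 M·B-symmetric Id≈P+M·B e f)))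

    B-inverse : IsInverse (Amat (suc m) K) B
    B-inverse = N⊕K-inverse {B} {Z} (+ (2 ℕ.* suc m) / 1) ((+ 1 / 2) * recip (suc m))
      (trans (cong (_* ((+ 1 / 2) * recip (suc m))) (2n≡n+n (suc m))) 2N*u/2≡1)
      (scheme-symmetric Bᶜ) Id≈K+M·B B≈M·Z+Id

0≤*0≤ : ∀ {x y : ℚ} → 0ℚ ℚ.≤ x → 0ℚ ℚ.≤ y → 0ℚ ℚ.≤ x * y
0≤*0≤ {x} {y} 0≤x 0≤y = ℚP.nonNegative⁻¹ (x * y) {{ℚP.nonNeg*nonNeg⇒nonNeg x {{ℚ.nonNegative 0≤x}} y {{ℚ.nonNegative 0≤y}}}}

0≤+0≤ : ∀ {x y : ℚ} → 0ℚ ℚ.≤ x → 0ℚ ℚ.≤ y → 0ℚ ℚ.≤ x + y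
0≤+0≤ {x} {y} 0≤x 0≤y = ℚP.nonNegative⁻¹ (x + y) {{ℚP.nonNeg+nonNeg⇒nonNeg x {{ℚ.nonNegative 0≤x}} y {{ℚ.nonNegative 0≤y}}}}

0≤ratio : ∀ k d → 0ℚ ℚ.≤ + k / suc d
0≤ratio k d = ℚP.nonNegative⁻¹ _ {{ℚP.normalize-nonNeg k (suc d)}}

maxFin-≤ : ∀ k (f : Fin k → ℚ) {b} → 0ℚ ℚ.≤ b → (∀ i → f i ℚ.≤ b) → maxFin k f ℚ.≤ b
maxFin-≤ zero    f 0≤b f≤b = 0≤b
maxFin-≤ (suc k) f 0≤b f≤b = ℚP.⊔-lub (f≤b zero) (maxFin-≤ k (λ i → f (suc i)) 0≤b (λ i → f≤b (suc i)))

normInf-≤ : ∀ {n} (X : EMat n) {b} → 0ℚ ℚ.≤ b → (∀ e → sumEdge n (λ f → ∣ X e f ∣) ℚ.≤ b) → normInf X ℚ.≤ b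
normInf-≤ {n} X 0≤b row≤b =
  maxFin-≤ 3 _ 0≤b (λ c → maxFin-≤ n _ 0≤b (λ i → maxFin-≤ n _ 0≤b (λ j → row≤b (c , i , j))))

module EntryValues (μ u : ℚ) (0≤μ : 0ℚ ℚ.≤ μ) (0≤u : 0ℚ ℚ.≤ u) ([1+μ]u≡1 : (1ℚ + μ) * u ≡ 1ℚ) where
  open InverseCoeffs (1ℚ + μ) u [1+μ]u≡1 using (Bᶜ)

  0≤u³ : 0ℚ ℚ.≤ u * u * u
  0≤u³ = 0≤*0≤ (0≤*0≤ 0≤u 0≤u) 0≤u

  both-equal one-equal none-equal other-class : ℚ
  both-equal  = μ * (u * u) + (+ 4 / 9) * (u * u * u)
  one-equal   = (+ 1 / 2) * (μ * (u * u * u)) + (+ 1 / 18) * (u * u * u)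
  none-equal  = (+ 4 / 9) * (u * u * u)
  other-class = (+ 1 / 18) * (u * u * u)

  ∣B∣-both-equal : ∣ entry Bᶜ (sameParts 1ℚ 1ℚ) ∣ ≡ both-equal
  ∣B∣-both-equal = begin
    ∣ entry Bᶜ (sameParts 1ℚ 1ℚ) ∣
      ≡⟨ cong ∣_∣ (via [1+μ]u≡1 (λ w → w * u - u * u + (+ 4 / 9) * (u * u * u)) (solve (μ ∷ u ∷ []) ℚ-ring) (solve (u ∷ []) ℚ-ring)) ⟨
    ∣ both-equal ∣
      ≡⟨ ℚP.0≤p⇒∣p∣≡p (0≤+0≤ (0≤*0≤ 0≤μ (0≤*0≤ 0≤u 0≤u)) (0≤*0≤ (0≤ratio 4 8) 0≤u³)) ⟩
    both-equal ∎

  0≤one-equal : 0ℚ ℚ.≤ one-equal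
  0≤one-equal = 0≤+0≤ (0≤*0≤ (0≤ratio 1 1) (0≤*0≤ 0≤μ 0≤u³)) (0≤*0≤ (0≤ratio 1 17) 0≤u³)

  ∣B∣-one-equal : ∣ entry Bᶜ (sameParts 1ℚ 0ℚ) ∣ ≡ one-equal
  ∣B∣-one-equal = begin
    ∣ entry Bᶜ (sameParts 1ℚ 0ℚ) ∣
      ≡⟨ cong ∣_∣ (via [1+μ]u≡1 (λ w → - ((+ 1 / 2) * (w * (u * u))) + (+ 4 / 9) * (u * u * u)) (solve (μ ∷ u ∷ []) ℚ-ring) (solve (u ∷ []) ℚ-ring)) ⟨
    ∣ - one-equal ∣
      ≡⟨ ℚP.∣-p∣≡∣p∣ one-equal ⟩
    ∣ one-equal ∣
      ≡⟨ ℚP.0≤p⇒∣p∣≡p 0≤one-equal ⟩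
    one-equal ∎

  ∣B∣-one-equal′ : ∣ entry Bᶜ (sameParts 0ℚ 1ℚ) ∣ ≡ one-equal
  ∣B∣-one-equal′ = trans (cong ∣_∣ (sameParts-comm Bᶜ 0ℚ 1ℚ)) ∣B∣-one-equal

  ∣B∣-none-equal : ∣ entry Bᶜ (sameParts 0ℚ 0ℚ) ∣ ≡ none-equal
  ∣B∣-none-equal = begin
    ∣ entry Bᶜ (sameParts 0ℚ 0ℚ) ∣ ≡⟨ cong ∣_∣ (solve (u ∷ []) ℚ-ring) ⟩
    ∣ none-equal ∣                 ≡⟨ ℚP.0≤p⇒∣p∣≡p (0≤*0≤ (0≤ratio 4 8) 0≤u³) ⟩
    none-equal                     ∎

  ∣B∣-other-class : ∀ x → ∣ entry Bᶜ (onePart x) ∣ ≡ other-class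
  ∣B∣-other-class x = begin
    ∣ entry Bᶜ (onePart x) ∣ ≡⟨ cong ∣_∣ (solve (x ∷ u ∷ []) ℚ-ring) ⟩
    ∣ - other-class ∣        ≡⟨ ℚP.∣-p∣≡∣p∣ other-class ⟩
    ∣ other-class ∣          ≡⟨ ℚP.0≤p⇒∣p∣≡p (0≤*0≤ (0≤ratio 1 17) 0≤u³) ⟩
    other-class              ∎

  -- Within its own class a row of B has one entry with both coordinates equal, 2μ with one and μ²
  -- with none; each other class contributes (1 + μ)² entries.
  same-class-total other-class-total slack : ℚ
  same-class-total  = (both-equal + μ * one-equal) + μ * (one-equal + μ * none-equal)
  other-class-total = (1ℚ + μ) * ((1ℚ + μ) * other-class)
  slack             = (+ 1 / 9) * ((+ 34 / 1) * μ + (+ 18 / 1)) * (u * u * u)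

  row-total+slack : same-class-total + (other-class-total + other-class-total) + slack ≡ (+ 23 / 9) * u
  row-total+slack = via [1+μ]u≡1 (λ w → w * u - u * u + (+ 14 / 9) * (w * w * u) + w * (u * u))
    (expand μ u) (solve (u ∷ []) ℚ-ring)
    where
    expand : ∀ μ u →
      ((μ * (u * u) + (+ 4 / 9) * (u * u * u)) + μ * ((+ 1 / 2) * (μ * (u * u * u)) + (+ 1 / 18) * (u * u * u)))
        + μ * (((+ 1 / 2) * (μ * (u * u * u)) + (+ 1 / 18) * (u * u * u)) + μ * ((+ 4 / 9) * (u * u * u)))
        + ((1ℚ + μ) * ((1ℚ + μ) * ((+ 1 / 18) * (u * u * u))) + (1ℚ + μ) * ((1ℚ + μ) * ((+ 1 / 18) * (u * u * u))))
        + (+ 1 / 9) * ((+ 34 / 1) * μ + (+ 18 / 1)) * (u * u * u)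
      ≡ (1ℚ + μ) * u * u - u * u + (+ 14 / 9) * ((1ℚ + μ) * u * ((1ℚ + μ) * u) * u) + (1ℚ + μ) * u * (u * u)
    expand = solve-∀ ℚ-ring

  row-total≤ : same-class-total + (other-class-total + other-class-total) ℚ.≤ (+ 23 / 9) * u
  row-total≤ = subst₂ ℚ._≤_ (ℚP.+-identityʳ total) row-total+slack (ℚP.+-monoʳ-≤ total 0≤slack)
    where
    total : ℚ
    total = same-class-total + (other-class-total + other-class-total)
    0≤slack : 0ℚ ℚ.≤ slack
    0≤slack = 0≤*0≤ (0≤*0≤ (0≤ratio 1 8) (0≤+0≤ (0≤*0≤ (0≤ratio 34 0) 0≤μ) (0≤ratio 18 0))) 0≤u³

module RowSum (m : ℕ) where
  open ExplicitInverse m using (B; Bᶜ)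
  open EntryValues (ι m) (recip (suc m)) (0≤ratio m 0) (0≤ratio 1 m) (trans (cong (_* recip (suc m)) (sym (ι-suc m))) (ι*recip m))

  same-class-block : ∀ (i j : Fin (suc m)) →
    sumFin (suc m) (λ i′ → sumFin (suc m) (λ j′ → ∣ entry Bᶜ (sameParts (δ i i′) (δ j j′)) ∣)) ≡ same-class-total
  same-class-block i j = begin
    sumFin (suc m) (λ i′ → sumFin (suc m) (λ j′ → ∣ entry Bᶜ (sameParts (δ i i′) (δ j j′)) ∣))
      ≡⟨ sumFin-cong (suc m) (λ i′ → sumFin-∘δ′ m (λ y → ∣ entry Bᶜ (sameParts (δ i i′) y) ∣) j) ⟩
    sumFin (suc m) (λ i′ → h (δ i i′))
      ≡⟨ sumFin-∘δ′ m h i ⟩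
    h 1ℚ + ι m * h 0ℚ
      ≡⟨ cong₂ (λ x y → x + ι m * y) (cong₂ (λ x y → x + ι m * y) ∣B∣-both-equal ∣B∣-one-equal)
                                     (cong₂ (λ x y → x + ι m * y) ∣B∣-one-equal′ ∣B∣-none-equal) ⟩
    same-class-total ∎
    where
    h : ℚ → ℚ
    h x = ∣ entry Bᶜ (sameParts x 1ℚ) ∣ + ι m * ∣ entry Bᶜ (sameParts x 0ℚ) ∣

  other-class-block : ∀ (X : Fin (suc m) → Fin (suc m) → ℚ) →
    sumFin (suc m) (λ i′ → sumFin (suc m) (λ j′ → ∣ entry Bᶜ (onePart (X i′ j′)) ∣)) ≡ other-class-total
  other-class-block X = begin
    sumFin (suc m) (λ i′ → sumFin (suc m) (λ j′ → ∣ entry Bᶜ (onePart (X i′ j′)) ∣))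
      ≡⟨ sumFin-cong (suc m) (λ i′ → trans (sumFin-cong (suc m) (λ j′ → ∣B∣-other-class (X i′ j′))) (sumFin-const (suc m) other-class)) ⟩
    sumFin (suc m) (λ _ → ι (suc m) * other-class)
      ≡⟨ sumFin-const (suc m) _ ⟩
    ι (suc m) * (ι (suc m) * other-class)
      ≡⟨ cong (λ N → N * (N * other-class)) (ι-suc m) ⟩
    other-class-total ∎

  row-sum : ∀ e → sumEdge (suc m) (λ f → ∣ B e f ∣) ≡ same-class-total + (other-class-total + other-class-total)
  row-sum (zero , i , j) = trans
    (cong₂ _+_ (same-class-block i j) (cong₂ _+_ (other-class-block (λ _ j′ → δ j j′)) (cong (_+ 0ℚ) (other-class-block (λ _ j′ → δ i j′)))))
    (first same-class-total other-class-total)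
    where
    first : ∀ S O → S + (O + (O + 0ℚ)) ≡ S + (O + O)
    first = solve-∀ ℚ-ring
  row-sum (suc zero , i , j) = trans
    (cong₂ _+_ (other-class-block (λ _ j′ → δ j j′)) (cong₂ _+_ (same-class-block i j) (cong (_+ 0ℚ) (other-class-block (λ i′ _ → δ i i′)))))
    (middle same-class-total other-class-total)
    where
    middle : ∀ S O → O + (S + (O + 0ℚ)) ≡ S + (O + O)
    middle = solve-∀ ℚ-ring
  row-sum (suc (suc zero) , i , j) = trans
    (cong₂ _+_ (other-class-block (λ i′ _ → δ j i′)) (cong₂ _+_ (other-class-block (λ i′ _ → δ i i′)) (cong (_+ 0ℚ) (same-class-block i j))))
    (last same-class-total other-class-total)
    where
    last : ∀ S O → O + (O + (S + 0ℚ)) ≡ S + (O + O)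
    last = solve-∀ ℚ-ring

  normInf≤ : ∀ {X} → X ≈ₘ B → normInf X ℚ.≤ (+ 23 / 9) * recip (suc m)
  normInf≤ {X} X≈B = normInf-≤ X (0≤*0≤ (0≤ratio 23 8) (0≤ratio 1 m)) row-sum≤
    where
    row-sum≤ : ∀ e → sumEdge (suc m) (λ f → ∣ X e f ∣) ℚ.≤ (+ 23 / 9) * recip (suc m)
    row-sum≤ e = subst (ℚ._≤ _) (sym (trans (Sum³.∑³-cong 3 (suc m) (suc m) (λ f → cong ∣_∣ (X≈B e f))) (row-sum e))) row-total≤

lemma5p1 : ((n : ℕ) → (K : EMat n) → IsOrthProjOntoKer (M n) K → Σ (EMat n) (λ B → IsInverse (Amat n K) B))
    × Σ ℚ (λ C → Σ ℕ (λ N → 1 ≤ N × ((n : ℕ) → N ≤ n → (K : EMat n) → IsOrthProjOntoKer (M n) K → (B : EMat n) → IsInverse (Amat n K) B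
    → (normInf B ℚ.≤ ((+ 23 / 9) * recip n) + (C * (recip n * recip n))))))
lemma5p1 = invertible , 0ℚ , 1 , s≤s z≤n , bound
  where
  invertible : (n : ℕ) → (K : EMat n) → IsOrthProjOntoKer (M n) K → Σ (EMat n) (λ B → IsInverse (Amat n K) B)
  invertible zero    K _      = 0ₘ , (λ { (_ , () , _) _ }) , (λ { (_ , () , _) _ })
  invertible (suc m) K K-proj = ExplicitInverse.B m , ExplicitInverse.B-inverse m K-proj

  bound : (n : ℕ) → 1 ≤ n → (K : EMat n) → IsOrthProjOntoKer (M n) K → (B : EMat n) → IsInverse (Amat n K) B
    → normInf B ℚ.≤ (+ 23 / 9) * recip n + 0ℚ * (recip n * recip n)
  bound (suc m) _ K K-proj B′ (_ , B′A≈I) =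
    subst (normInf B′ ℚ.≤_) (sym no-second-order-term)
      (RowSum.normInf≤ m (inverse-unique {A = Amat (suc m) K} {B′} (proj₁ (ExplicitInverse.B-inverse m K-proj)) B′A≈I))
    where
    u : ℚ
    u = recip (suc m)
    no-second-order-term : (+ 23 / 9) * u + 0ℚ * (u * u) ≡ (+ 23 / 9) * u
    no-second-order-term = trans (cong (_+_ ((+ 23 / 9) * u)) (ℚP.*-zeroˡ (u * u))) (ℚP.+-identityʳ ((+ 23 / 9) * u))
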